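{- Let $\phi$ be a homogeneously monadic formula (a monadic difference formula in positive form with predicates among $P_1,\dots,P_l$ in which no $P_j$ occurs both as a positive literal $P_j(x)$ and as a negative literal $\neg P_j(y)$). Let $\phi^0$ (resp. $\phi^1$) be obtained from the literal version $\hat\phi$ by replacing every literal atom $L_i(x)$, $i=1,\dots,2l$, by the constant false (resp. true). Then: (1) $\phi^0$ is a tautology if and only if $\phi$ is a tautology; (2) $\phi^1$ is unsatisfiable if and only if $\phi$ is unsatisfiable.
   Context: $\mathbb{R}_+$ denotes the non-negative reals. Monadic difference formulae in positive form over predicate symbols $P_1,\dots,P_l$ are given by \[ \phi::=P_j(x)\mid\neg P_j(x)\mid x-y\le c\mid\neg(x-y\le c)\mid\phi_1\wedge\phi_2\mid\phi_1\vee\phi_2\mid\forall x.\phi\mid\exists x.\phi , \] with $c$ a real constant. Variables range over $\mathbb{R}_+$. An interpretation assigns values in $\mathbb{R}_+$ to free variables and subsets $S_j\subseteq\mathbb{R}_+$ to the $P_j$ ($P_j(x)$ holds iff the value of $x$ is in $S_j$); quantifiers range over $\mathbb{R}_+$. The literal version $\hat\phi$ replaces each occurrence of $P_j(x)$ by $L_j(x)$ and each occurrence of $\neg P_j(x)$ by $L_{l+j}(x)$. A formula is a tautology if it is true under every interpretation of its free variables and predicates, and unsatisfiable if it is true under none. -}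

module Defs where

open import Data.Nat using (ℕ; suc) renaming (_+_ to _+ℕ_)
open import Data.Fin using (Fin; zero; suc; _↑ˡ_; _↑ʳ_)
open import Data.Bool using (Bool; true; false)
open import Data.Product using (Σ; _×_; _,_)
open import Data.Sum using (_⊎_)
open import Data.Unit using (⊤)
open import Data.Empty using (⊥)
open import Relation.Nullary using (¬_)
open import Relation.Binary.PropositionalEquality using (_≡_)
open import Algebra.Structures using (IsCommutativeRing)
open import Relation.Binary.Structures using (IsTotalOrder)

-- The real numbers, given axiomatically as a Dedekind-complete ordered
-- field (the standard library has no reals).  Any such structure is
-- (classically) isomorphic to ℝ.

record Reals : Set₁ where
  infixl 6 _+_
  infixl 7 _*_
  infix  4 _≤_
  field
    ℝ     : Set
    0ℝ 1ℝ : ℝ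
    _+_ _*_ : ℝ → ℝ → ℝ
    -_    : ℝ → ℝ
    _≤_   : ℝ → ℝ → Set
    isCommutativeRing : IsCommutativeRing _≡_ _+_ _*_ -_ 0ℝ 1ℝ
    0≢1   : ¬ (0ℝ ≡ 1ℝ)
    inverse : ∀ x → ¬ (x ≡ 0ℝ) → Σ ℝ (λ y → x * y ≡ 1ℝ)
    isTotalOrder : IsTotalOrder _≡_ _≤_
    +-mono-≤ : ∀ {x y} z → x ≤ y → x + z ≤ y + z
    *-nonneg : ∀ {x y} → 0ℝ ≤ x → 0ℝ ≤ y → 0ℝ ≤ x * y
    sup : (A : ℝ → Set) → Σ ℝ A → Σ ℝ (λ b → ∀ a → A a → a ≤ b) →
          Σ ℝ (λ s → (∀ a → A a → a ≤ s) × (∀ b → (∀ a → A a → a ≤ b) → s ≤ b))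

  _-_ : ℝ → ℝ → ℝ
  x - y = x + (- y)

  ℝ₊ : Set
  ℝ₊ = Σ ℝ (λ x → 0ℝ ≤ x)

  val : ℝ₊ → ℝ
  val (x , _) = x

module WithReals (R : Reals) where
  open Reals R

  ext : ∀ {n} → ℝ₊ → (Fin n → ℝ₊) → Fin (suc n) → ℝ₊
  ext a ρ zero    = a
  ext a ρ (suc i) = ρ i

  data Formula (l : ℕ) : ℕ → Set where
    P    : ∀ {n} → Fin l → Fin n → Formula l n
    ¬P   : ∀ {n} → Fin l → Fin n → Formula l n
    dle  : ∀ {n} → Fin n → Fin n → ℝ → Formula l n
    ¬dle : ∀ {n} → Fin n → Fin n → ℝ → Formula l n
    _∧_  : ∀ {n} → Formula l n → Formula l n → Formula l n
    _∨_  : ∀ {n} → Formula l n → Formula l n → Formula l n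
    ∀′   : ∀ {n} → Formula l (suc n) → Formula l n
    ∃′   : ∀ {n} → Formula l (suc n) → Formula l n

  ⟦_⟧ : ∀ {l n} → Formula l n → (Fin l → ℝ₊ → Set) → (Fin n → ℝ₊) → Set
  ⟦ P j x ⟧      S ρ = S j (ρ x)
  ⟦ ¬P j x ⟧     S ρ = ¬ S j (ρ x)
  ⟦ dle x y c ⟧  S ρ = val (ρ x) - val (ρ y) ≤ c
  ⟦ ¬dle x y c ⟧ S ρ = ¬ (val (ρ x) - val (ρ y) ≤ c)
  ⟦ φ ∧ ψ ⟧      S ρ = ⟦ φ ⟧ S ρ × ⟦ ψ ⟧ S ρ
  ⟦ φ ∨ ψ ⟧      S ρ = ⟦ φ ⟧ S ρ ⊎ ⟦ ψ ⟧ S ρ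
  ⟦ ∀′ φ ⟧       S ρ = (a : ℝ₊) → ⟦ φ ⟧ S (ext a ρ)
  ⟦ ∃′ φ ⟧       S ρ = Σ ℝ₊ (λ a → ⟦ φ ⟧ S (ext a ρ))

  Tautology : ∀ {l n} → Formula l n → Set₁
  Tautology {l} {n} φ = (S : Fin l → ℝ₊ → Set) (ρ : Fin n → ℝ₊) → ⟦ φ ⟧ S ρ

  Unsatisfiable : ∀ {l n} → Formula l n → Set₁
  Unsatisfiable {l} {n} φ =
    ¬ Σ (Fin l → ℝ₊ → Set) (λ S → Σ (Fin n → ℝ₊) (λ ρ → ⟦ φ ⟧ S ρ))

  OccPos : ∀ {l n} → Fin l → Formula l n → Set
  OccPos j (P k x)      = j ≡ k
  OccPos j (¬P k x)     = ⊥
  OccPos j (dle x y c)  = ⊥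
  OccPos j (¬dle x y c) = ⊥
  OccPos j (φ ∧ ψ)      = OccPos j φ ⊎ OccPos j ψ
  OccPos j (φ ∨ ψ)      = OccPos j φ ⊎ OccPos j ψ
  OccPos j (∀′ φ)       = OccPos j φ
  OccPos j (∃′ φ)       = OccPos j φ

  OccNeg : ∀ {l n} → Fin l → Formula l n → Set
  OccNeg j (P k x)      = ⊥
  OccNeg j (¬P k x)     = j ≡ k
  OccNeg j (dle x y c)  = ⊥
  OccNeg j (¬dle x y c) = ⊥
  OccNeg j (φ ∧ ψ)      = OccNeg j φ ⊎ OccNeg j ψ
  OccNeg j (φ ∨ ψ)      = OccNeg j φ ⊎ OccNeg j ψ
  OccNeg j (∀′ φ)       = OccNeg j φ
  OccNeg j (∃′ φ)       = OccNeg j φ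

  Homogeneous : ∀ {l n} → Formula l n → Set
  Homogeneous {l} φ = (j : Fin l) → ¬ (OccPos j φ × OccNeg j φ)

  data LFormula (m : ℕ) : ℕ → Set where
    L    : ∀ {n} → Fin m → Fin n → LFormula m n
    dle  : ∀ {n} → Fin n → Fin n → ℝ → LFormula m n
    ¬dle : ∀ {n} → Fin n → Fin n → ℝ → LFormula m n
    _∧_  : ∀ {n} → LFormula m n → LFormula m n → LFormula m n
    _∨_  : ∀ {n} → LFormula m n → LFormula m n → LFormula m n
    ∀′   : ∀ {n} → LFormula m (suc n) → LFormula m n
    ∃′   : ∀ {n} → LFormula m (suc n) → LFormula m n

  -- literal version φ̂ : P_j ↦ L_j, ¬P_j ↦ L_{l+j}  (0-indexed Fin (l + l))
  hat : ∀ {l n} → Formula l n → LFormula (l +ℕ l) n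
  hat {l} (P j x)  = L (j ↑ˡ l) x
  hat {l} (¬P j x) = L (l ↑ʳ j) x
  hat (dle x y c)  = dle x y c
  hat (¬dle x y c) = ¬dle x y c
  hat (φ ∧ ψ)      = hat φ ∧ hat ψ
  hat (φ ∨ ψ)      = hat φ ∨ hat ψ
  hat (∀′ φ)       = ∀′ (hat φ)
  hat (∃′ φ)       = ∃′ (hat φ)

  data DFormula : ℕ → Set where
    tt ff : ∀ {n} → DFormula n
    dle  : ∀ {n} → Fin n → Fin n → ℝ → DFormula n
    ¬dle : ∀ {n} → Fin n → Fin n → ℝ → DFormula n
    _∧_  : ∀ {n} → DFormula n → DFormula n → DFormula n
    _∨_  : ∀ {n} → DFormula n → DFormula n → DFormula n
    ∀′   : ∀ {n} → DFormula (suc n) → DFormula n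
    ∃′   : ∀ {n} → DFormula (suc n) → DFormula n

  ⟦_⟧ᴰ : ∀ {n} → DFormula n → (Fin n → ℝ₊) → Set
  ⟦ tt ⟧ᴰ          ρ = ⊤
  ⟦ ff ⟧ᴰ          ρ = ⊥
  ⟦ dle x y c ⟧ᴰ   ρ = val (ρ x) - val (ρ y) ≤ c
  ⟦ ¬dle x y c ⟧ᴰ  ρ = ¬ (val (ρ x) - val (ρ y) ≤ c)
  ⟦ φ ∧ ψ ⟧ᴰ       ρ = ⟦ φ ⟧ᴰ ρ × ⟦ ψ ⟧ᴰ ρ
  ⟦ φ ∨ ψ ⟧ᴰ       ρ = ⟦ φ ⟧ᴰ ρ ⊎ ⟦ ψ ⟧ᴰ ρ
  ⟦ ∀′ φ ⟧ᴰ        ρ = (a : ℝ₊) → ⟦ φ ⟧ᴰ (ext a ρ)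
  ⟦ ∃′ φ ⟧ᴰ        ρ = Σ ℝ₊ (λ a → ⟦ φ ⟧ᴰ (ext a ρ))

  TautologyD : ∀ {n} → DFormula n → Set
  TautologyD {n} φ = (ρ : Fin n → ℝ₊) → ⟦ φ ⟧ᴰ ρ

  UnsatisfiableD : ∀ {n} → DFormula n → Set
  UnsatisfiableD {n} φ = ¬ Σ (Fin n → ℝ₊) (λ ρ → ⟦ φ ⟧ᴰ ρ)

  replaceLits : ∀ {m n} → Bool → LFormula m n → DFormula n
  replaceLits false (L i x) = ff
  replaceLits true  (L i x) = tt
  replaceLits b (dle x y c)  = dle x y c
  replaceLits b (¬dle x y c) = ¬dle x y c
  replaceLits b (φ ∧ ψ)      = replaceLits b φ ∧ replaceLits b ψ
  replaceLits b (φ ∨ ψ)      = replaceLits b φ ∨ replaceLits b ψ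
  replaceLits b (∀′ φ)       = ∀′ (replaceLits b φ)
  replaceLits b (∃′ φ)       = ∃′ (replaceLits b φ)

  φ⁰ : ∀ {l n} → Formula l n → DFormula n
  φ⁰ φ = replaceLits false (hat φ)

  φ¹ : ∀ {l n} → Formula l n → DFormula n
  φ¹ φ = replaceLits true (hat φ)

-- Since φ is in positive form, replacing all its literals by false (true) weakens
-- (strengthens) it: φ⁰ ⇒ φ ⇒ φ¹ under every interpretation.  Conversely, by
-- homogeneity, taking P_j to be all of ℝ₊ if P_j occurs negatively and empty otherwise
-- falsifies every literal of φ, so under this interpretation φ ⇒ φ⁰; dually, taking
-- P_j to be ℝ₊ exactly when P_j occurs positively makes every literal true, and φ¹ ⇒ φ.
module Submission where

open import Defs
open import Data.Nat using (ℕ)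
open import Data.Fin using (Fin)
open import Data.Bool using (Bool; true; false; T)
open import Data.Product using (_×_; _,_)
open import Data.Sum using (inj₁; inj₂)
open import Data.Empty using (⊥-elim)
open import Function.Base using (_∘_; id)
open import Function.Bundles using (_⇔_; mk⇔; Equivalence)
open import Relation.Binary.PropositionalEquality using (refl)
open import Relation.Nullary using (¬_)

open Equivalence using (to; from)

module _ (R : Reals) where
  open Reals R
  open WithReals R

  private
    variable
      l m n : ℕ

  φ⁰⇒φ : (φ : Formula l n) (S : Fin l → ℝ₊ → Set) (ρ : Fin n → ℝ₊) →
         ⟦ φ⁰ φ ⟧ᴰ ρ → ⟦ φ ⟧ S ρ
  φ⁰⇒φ (P j x)      S ρ ()
  φ⁰⇒φ (¬P j x)     S ρ ()
  φ⁰⇒φ (dle x y c)  S ρ h          = h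
  φ⁰⇒φ (¬dle x y c) S ρ h          = h
  φ⁰⇒φ (φ ∧ ψ)      S ρ (hφ , hψ)  = φ⁰⇒φ φ S ρ hφ , φ⁰⇒φ ψ S ρ hψ
  φ⁰⇒φ (φ ∨ ψ)      S ρ (inj₁ hφ)  = inj₁ (φ⁰⇒φ φ S ρ hφ)
  φ⁰⇒φ (φ ∨ ψ)      S ρ (inj₂ hψ)  = inj₂ (φ⁰⇒φ ψ S ρ hψ)
  φ⁰⇒φ (∀′ φ)       S ρ h          = λ a → φ⁰⇒φ φ S (ext a ρ) (h a)
  φ⁰⇒φ (∃′ φ)       S ρ (a , h)    = a , φ⁰⇒φ φ S (ext a ρ) h

  φ⇒φ¹ : (φ : Formula l n) (S : Fin l → ℝ₊ → Set) (ρ : Fin n → ℝ₊) →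
         ⟦ φ ⟧ S ρ → ⟦ φ¹ φ ⟧ᴰ ρ
  φ⇒φ¹ (P j x)      S ρ h          = _
  φ⇒φ¹ (¬P j x)     S ρ h          = _
  φ⇒φ¹ (dle x y c)  S ρ h          = h
  φ⇒φ¹ (¬dle x y c) S ρ h          = h
  φ⇒φ¹ (φ ∧ ψ)      S ρ (hφ , hψ)  = φ⇒φ¹ φ S ρ hφ , φ⇒φ¹ ψ S ρ hψ
  φ⇒φ¹ (φ ∨ ψ)      S ρ (inj₁ hφ)  = inj₁ (φ⇒φ¹ φ S ρ hφ)
  φ⇒φ¹ (φ ∨ ψ)      S ρ (inj₂ hψ)  = inj₂ (φ⇒φ¹ ψ S ρ hψ)
  φ⇒φ¹ (∀′ φ)       S ρ h          = λ a → φ⇒φ¹ φ S (ext a ρ) (h a)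
  φ⇒φ¹ (∃′ φ)       S ρ (a , h)    = a , φ⇒φ¹ φ S (ext a ρ) h

  record LiteralsTake (b : Bool) (S : Fin l → ℝ₊ → Set) (φ : Formula l n) : Set where
    field
      positive : ∀ j → OccPos j φ → ∀ a → S j a ⇔ T b
      negative : ∀ j → OccNeg j φ → ∀ a → (¬ S j a) ⇔ T b

  open LiteralsTake

  LiteralsTake-⊆ : ∀ {b S} {φ : Formula l n} {ψ : Formula l m} →
                   (∀ j → OccPos j ψ → OccPos j φ) → (∀ j → OccNeg j ψ → OccNeg j φ) →
                   LiteralsTake b S φ → LiteralsTake b S ψ
  LiteralsTake-⊆ pos⊆ neg⊆ lits = record
    { positive = λ j → positive lits j ∘ pos⊆ j
    ; negative = λ j → negative lits j ∘ neg⊆ j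
    }

  φ⇒φ⁰ : (φ : Formula l n) (S : Fin l → ℝ₊ → Set) → LiteralsTake false S φ →
         (ρ : Fin n → ℝ₊) → ⟦ φ ⟧ S ρ → ⟦ φ⁰ φ ⟧ᴰ ρ
  φ⇒φ⁰ (P j x)      S lits ρ h         = to (positive lits j refl (ρ x)) h
  φ⇒φ⁰ (¬P j x)     S lits ρ h         = to (negative lits j refl (ρ x)) h
  φ⇒φ⁰ (dle x y c)  S lits ρ h         = h
  φ⇒φ⁰ (¬dle x y c) S lits ρ h         = h
  φ⇒φ⁰ (φ ∧ ψ)      S lits ρ (hφ , hψ) =
    φ⇒φ⁰ φ S (LiteralsTake-⊆ (λ _ → inj₁) (λ _ → inj₁) lits) ρ hφ ,
    φ⇒φ⁰ ψ S (LiteralsTake-⊆ (λ _ → inj₂) (λ _ → inj₂) lits) ρ hψ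
  φ⇒φ⁰ (φ ∨ ψ)      S lits ρ (inj₁ hφ) =
    inj₁ (φ⇒φ⁰ φ S (LiteralsTake-⊆ (λ _ → inj₁) (λ _ → inj₁) lits) ρ hφ)
  φ⇒φ⁰ (φ ∨ ψ)      S lits ρ (inj₂ hψ) =
    inj₂ (φ⇒φ⁰ ψ S (LiteralsTake-⊆ (λ _ → inj₂) (λ _ → inj₂) lits) ρ hψ)
  φ⇒φ⁰ (∀′ φ)       S lits ρ h         =
    λ a → φ⇒φ⁰ φ S (LiteralsTake-⊆ (λ _ → id) (λ _ → id) lits) (ext a ρ) (h a)
  φ⇒φ⁰ (∃′ φ)       S lits ρ (a , h)   =
    a , φ⇒φ⁰ φ S (LiteralsTake-⊆ (λ _ → id) (λ _ → id) lits) (ext a ρ) h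

  φ¹⇒φ : (φ : Formula l n) (S : Fin l → ℝ₊ → Set) → LiteralsTake true S φ →
         (ρ : Fin n → ℝ₊) → ⟦ φ¹ φ ⟧ᴰ ρ → ⟦ φ ⟧ S ρ
  φ¹⇒φ (P j x)      S lits ρ h         = from (positive lits j refl (ρ x)) h
  φ¹⇒φ (¬P j x)     S lits ρ h         = from (negative lits j refl (ρ x)) h
  φ¹⇒φ (dle x y c)  S lits ρ h         = h
  φ¹⇒φ (¬dle x y c) S lits ρ h         = h
  φ¹⇒φ (φ ∧ ψ)      S lits ρ (hφ , hψ) =
    φ¹⇒φ φ S (LiteralsTake-⊆ (λ _ → inj₁) (λ _ → inj₁) lits) ρ hφ ,
    φ¹⇒φ ψ S (LiteralsTake-⊆ (λ _ → inj₂) (λ _ → inj₂) lits) ρ hψ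
  φ¹⇒φ (φ ∨ ψ)      S lits ρ (inj₁ hφ) =
    inj₁ (φ¹⇒φ φ S (LiteralsTake-⊆ (λ _ → inj₁) (λ _ → inj₁) lits) ρ hφ)
  φ¹⇒φ (φ ∨ ψ)      S lits ρ (inj₂ hψ) =
    inj₂ (φ¹⇒φ ψ S (LiteralsTake-⊆ (λ _ → inj₂) (λ _ → inj₂) lits) ρ hψ)
  φ¹⇒φ (∀′ φ)       S lits ρ h         =
    λ a → φ¹⇒φ φ S (LiteralsTake-⊆ (λ _ → id) (λ _ → id) lits) (ext a ρ) (h a)
  φ¹⇒φ (∃′ φ)       S lits ρ (a , h)   =
    a , φ¹⇒φ φ S (LiteralsTake-⊆ (λ _ → id) (λ _ → id) lits) (ext a ρ) h

  homogeneous⇒literalsFalse : (φ : Formula l n) → Homogeneous φ →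
                              LiteralsTake false (λ j _ → OccNeg j φ) φ
  homogeneous⇒literalsFalse φ hom = record
    { positive = λ j pos _ → mk⇔ (λ neg → hom j (pos , neg)) ⊥-elim
    ; negative = λ j neg _ → mk⇔ (λ ¬neg → ¬neg neg) ⊥-elim
    }

  homogeneous⇒literalsTrue : (φ : Formula l n) → Homogeneous φ →
                             LiteralsTake true (λ j _ → OccPos j φ) φ
  homogeneous⇒literalsTrue φ hom = record
    { positive = λ j pos _ → mk⇔ _ (λ _ → pos)
    ; negative = λ j neg _ → mk⇔ _ (λ _ pos → hom j (pos , neg))
    }

  tautology-φ⁰⇔tautology : (φ : Formula l n) → Homogeneous φ →
                           TautologyD (φ⁰ φ) ⇔ Tautology φ
  tautology-φ⁰⇔tautology φ hom = mk⇔
    (λ taut⁰ S ρ → φ⁰⇒φ φ S ρ (taut⁰ ρ))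
    (λ taut ρ → φ⇒φ⁰ φ S⁰ lits ρ (taut S⁰ ρ))
    where
      S⁰ : Fin _ → ℝ₊ → Set
      S⁰ j _ = OccNeg j φ

      lits : LiteralsTake false S⁰ φ
      lits = homogeneous⇒literalsFalse φ hom

  unsatisfiable-φ¹⇔unsatisfiable : (φ : Formula l n) → Homogeneous φ →
                                   UnsatisfiableD (φ¹ φ) ⇔ Unsatisfiable φ
  unsatisfiable-φ¹⇔unsatisfiable φ hom = mk⇔
    (λ unsat¹ (S , ρ , h) → unsat¹ (ρ , φ⇒φ¹ φ S ρ h))
    (λ unsat (ρ , h) → unsat (S¹ , ρ , φ¹⇒φ φ S¹ lits ρ h))
    where
      S¹ : Fin _ → ℝ₊ → Set
      S¹ j _ = OccPos j φ

      lits : LiteralsTake true S¹ φ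
      lits = homogeneous⇒literalsTrue φ hom

mainTheorem3 : (R : Reals) → let open WithReals R in
    ∀ {l n : ℕ} (φ : Formula l n) → Homogeneous φ →
      (TautologyD (φ⁰ φ) ⇔ Tautology φ) × (UnsatisfiableD (φ¹ φ) ⇔ Unsatisfiable φ)
mainTheorem3 R φ hom =
  tautology-φ⁰⇔tautology R φ hom , unsatisfiable-φ¹⇔unsatisfiable R φ hom
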